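{- Let $\mathcal{J}_3$ be the set of the $12$ open intervals $(a,b)$ with integers $0 \le a < b \le 5$ and $b - a \in \{1,2,3\}$. Then the intersection graph of $\mathcal{J}_3$ has claw number $3$, admits a partition of its vertex set into three subsets each inducing a subgraph with claw number at most $1$, but admits no partition of its vertex set into two subsets each inducing a subgraph with claw number at most $1$.
   Context: The intersection graph of a family of sets has one vertex per set, two vertices adjacent iff the sets intersect. The claw number of a graph $G$ is the largest integer $v \ge 0$ such that the star $K_{1,v}$ is an induced subgraph of $G$. -}

module Defs where

open import Data.Nat using (ℕ; _<_; _≤_; _∸_)
open import Data.Integer using (+_)
open import Data.Rational as ℚ using (ℚ; _/_)
open import Data.Fin using (Fin)
open import Data.Product using (Σ; _×_; ∃)
open import Data.Sum using (_⊎_)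
open import Relation.Binary.PropositionalEquality using (_≡_; _≢_)
open import Relation.Nullary using (¬_)

record Graph : Set₁ where
  field
    V   : Set
    Adj : V → V → Set

open Graph public

InducedStarIn : (G : Graph) → (V G → Set) → ℕ → Set
InducedStarIn G P v =
  Σ (V G) λ c → Σ (Fin v → V G) λ ℓ →
      P c
    × (∀ i → P (ℓ i))
    × (∀ i → ℓ i ≢ c)
    × (∀ i j → i ≢ j → ℓ i ≢ ℓ j)
    × (∀ i → Adj G c (ℓ i))
    × (∀ i j → i ≢ j → ¬ Adj G (ℓ i) (ℓ j))

InducedStar : Graph → ℕ → Set
InducedStar G v = InducedStarIn G (λ _ → Data.Unit.⊤) v
  where import Data.Unit

ClawNumber : Graph → ℕ → Set
ClawNumber G v = InducedStar G v × (∀ w → InducedStar G w → w ≤ v)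

InducedClawAtMost : (G : Graph) → (V G → Set) → ℕ → Set
InducedClawAtMost G P n = ∀ w → InducedStarIn G P w → w ≤ n

PartitionClawAtMost : (G : Graph) → (k n : ℕ) → Set
PartitionClawAtMost G k n =
  Σ (V G → Fin k) λ π → ∀ (p : Fin k) → InducedClawAtMost G (λ x → π x ≡ p) n

⟦_⟧ : ℕ → ℚ
⟦ n ⟧ = + n / 1

OpenInterval : ℕ → ℕ → ℚ → Set
OpenInterval a b q = ⟦ a ⟧ ℚ.< q × q ℚ.< ⟦ b ⟧

record J₃ : Set where
  constructor iv
  field
    a   : ℕ
    b   : ℕ
    a<b : a < b
    b≤5 : b ≤ 5
    len : (b ∸ a ≡ 1) ⊎ (b ∸ a ≡ 2) ⊎ (b ∸ a ≡ 3)

IntersectionGraph-J₃ : Graph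
IntersectionGraph-J₃ = record
  { V   = J₃
  ; Adj = λ I J → I ≢ J ×
            ∃ λ q → OpenInterval (J₃.a I) (J₃.b I) q × OpenInterval (J₃.a J) (J₃.b J) q
  }

-- An induced star centred at I has at most right I - left I ≤ 3 leaves: its leaves are pairwise
-- disjoint, so the integer points max(left I, left ℓ) at which they begin to meet I are distinct
-- points of [left I, right I). The unit intervals inside (1,4) form a star with three leaves.
-- Colouring by left end mod 3 works: intervals of length ≤ 3 with congruent left ends overlap only
-- if their left ends coincide, so no colour class contains a cherry (an induced K_{1,2}).
-- With two colours, (0,3) and any interval meeting it but none of (0,1), (0,2), (1,2) must get
-- different colours, for otherwise (0,1), (0,2), (1,2) all take the other colour and form a
-- cherry at (0,2). So (2,3) and (2,5) both differ from (0,3), while the mirror image of this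
-- argument separates (2,3) from (2,5).
module Submission where

open import Defs
open import Data.Empty using (⊥)
open import Data.Fin using (Fin; zero; suc; fromℕ<; inject≤)
open import Data.Fin.Properties using (all?; inject≤-injective; fromℕ<-injective; injective⇒≤)
  renaming (_≟_ to _≟ᶠ_)
open import Data.Integer as ℤ using (+_; +<+; +≤+)
import Data.Integer.Properties as ℤ
open import Data.Nat using (ℕ; suc; _+_; _*_; _∸_; _⊔_; _<_; _≤_; _≤?_; _<?_; _≟_; z≤n; s≤s; NonZero)
open import Data.Nat.DivMod using (_%_; _/_; _mod_; m≡m%n+[m/n]*n)
import Data.Nat.Coprimality as Coprime
open import Data.Nat.Properties
  using (+-commutativeSemigroup; module ≤-Reasoning; <⇒≤; <-≤-trans; ≤-trans; ≤-reflexive; ≤-<-trans;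
         ≰⇒>; ≤⇒≯; <-cmp; m≤m⊔n; m≤n⊔m; m⊓n≤m; m⊓n≤n; ⊔-pres-<m; ⊓-pres-m<; ∸-monoˡ-<; ∸-cancelʳ-≡;
         m∸n+n≡m; +-monoˡ-≤; +-mono-≤; *-monoˡ-≤)
open import Algebra.Properties.CommutativeSemigroup +-commutativeSemigroup using (x∙yz≈y∙xz)
open import Data.Product using (Σ; _×_; _,_; proj₁; proj₂)
open import Data.Rational as ℚ using (ℚ; mkℚ; *<*; *≤*)
import Data.Rational.Properties as ℚ
open import Data.Sum using (_⊎_; inj₁; inj₂)
open import Data.Vec.Functional using (_∷_; [])
open import Function using (_∘_)
open import Function.Definitions using (Injective)
open import Relation.Binary using (tri<; tri≈; tri>)
open import Relation.Binary.PropositionalEquality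
open import Relation.Nullary using (¬_; Dec; yes; no; contradiction)
open import Relation.Nullary.Decidable
  using (True; toWitness; decidable-stable; ¬?; _×-dec_; _⊎-dec_; _→-dec_)

≢-≢⇒≡ : {i j k : Fin 2} → i ≢ k → j ≢ k → i ≡ j
≢-≢⇒≡ {zero}     {zero}                 _   _   = refl
≢-≢⇒≡ {suc zero} {suc zero}             _   _   = refl
≢-≢⇒≡ {zero}     {suc zero} {zero}      i≢k _   = contradiction refl i≢k
≢-≢⇒≡ {zero}     {suc zero} {suc zero}  _   j≢k = contradiction refl j≢k
≢-≢⇒≡ {suc zero} {zero}     {zero}      _   j≢k = contradiction refl j≢k
≢-≢⇒≡ {suc zero} {zero}     {suc zero}  i≢k _   = contradiction refl i≢k

-- InducedStarIn G P n unfolds to Σ c, Σ ℓ, P c × (∀ i → P (ℓ i)) × IsInducedStar G c ℓ.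
IsInducedStar : (G : Graph) {n : ℕ} → V G → (Fin n → V G) → Set
IsInducedStar G c ℓ =
    (∀ i → ℓ i ≢ c)
  × (∀ i j → i ≢ j → ℓ i ≢ ℓ j)
  × (∀ i → Adj G c (ℓ i))
  × (∀ i j → i ≢ j → ¬ Adj G (ℓ i) (ℓ j))

Cherry : (G : Graph) → V G → V G → V G → Set
Cherry G x c y = IsInducedStar G c (x ∷ y ∷ [])

injective-into-range⇒≤ : ∀ {w m n} (f : Fin w → ℕ) → (∀ i → m ≤ f i × f i < n) →
                         Injective _≡_ _≡_ f → w ≤ n ∸ m
injective-into-range⇒≤ {w} {m} {n} f range f-inj = injective⇒≤ g-inj
  where
  g : Fin w → Fin (n ∸ m)
  g i = fromℕ< (∸-monoˡ-< (proj₂ (range i)) (proj₁ (range i)))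
  g-inj : Injective _≡_ _≡_ g
  g-inj {i} {j} eq =
    f-inj (∸-cancelʳ-≡ (proj₁ (range i)) (proj₁ (range j)) (fromℕ<-injective _ _ _ _ eq))

module _ {G : Graph} where

  inducedStarIn-≤ : ∀ {P m n} → m ≤ n → InducedStarIn G P n → InducedStarIn G P m
  inducedStarIn-≤ m≤n (c , ℓ , c∈P , ℓ∈P , ℓ≢c , ℓ-inj , adj , nonadj) =
    c , ℓ ∘ ι , c∈P , ℓ∈P ∘ ι , ℓ≢c ∘ ι , (λ i j → ℓ-inj (ι i) (ι j) ∘ ι-inj i j) ,
    adj ∘ ι , (λ i j → nonadj (ι i) (ι j) ∘ ι-inj i j)
    where
    ι : Fin _ → Fin _
    ι i = inject≤ i m≤n
    ι-inj : ∀ i j → i ≢ j → ι i ≢ ι j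
    ι-inj i j i≢j = i≢j ∘ inject≤-injective m≤n m≤n i j

  noInducedStar⇒clawAtMost : ∀ {P n} → ¬ InducedStarIn G P (suc n) → InducedClawAtMost G P n
  noInducedStar⇒clawAtMost {n = n} ¬star w star with w ≤? n
  ... | yes w≤n = w≤n
  ... | no  w≰n = contradiction (inducedStarIn-≤ (≰⇒> w≰n) star) ¬star

  module _ {k : ℕ} (π : V G → Fin k) (clawFree : ∀ p → InducedClawAtMost G (λ v → π v ≡ p) 1) where

    cherry-not-monochromatic : ∀ {x c y} → Cherry G x c y → π x ≡ π c → π y ≡ π c → ⊥
    cherry-not-monochromatic {x} {c} {y} cherry πx≡πc πy≡πc =
      contradiction (clawFree (π c) 2 (c , x ∷ y ∷ [] , refl , leaves∈πc , cherry)) λ { (s≤s ()) }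
      where
      leaves∈πc : ∀ i → π ((x ∷ y ∷ []) i) ≡ π c
      leaves∈πc zero       = πx≡πc
      leaves∈πc (suc zero) = πy≡πc

module TwoParts {G : Graph} (π : V G → Fin 2)
                (clawFree : ∀ p → InducedClawAtMost G (λ v → π v ≡ p) 1) where

  -- Each w ∈ {x, h, y} is kept out of the part of c (else w, c, z would be a monochromatic
  -- cherry), so with only two parts x, h and y share a part.
  fan-separates : ∀ x h y c z → Cherry G x h y → Cherry G x c z → Cherry G h c z → Cherry G y c z →
                  π z ≢ π c
  fan-separates x h y c z xhy xcz hcz ycz πz≡πc =
    cherry-not-monochromatic {G} π clawFree xhy
      (≢-≢⇒≡ (avoids xcz) (avoids hcz)) (≢-≢⇒≡ (avoids ycz) (avoids hcz))
    where
    avoids : ∀ {w} → Cherry G w c z → π w ≢ π c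
    avoids wcz πw≡πc = cherry-not-monochromatic {G} π clawFree wcz πw≡πc πz≡πc

⟦⟧≡mkℚ : ∀ n → ⟦ n ⟧ ≡ mkℚ (+ n) 0 (Coprime.sym (Coprime.1-coprimeTo n))
⟦⟧≡mkℚ n = ℚ.normalize-coprime (Coprime.sym (Coprime.1-coprimeTo n))

⟦⟧-cancel-< : ∀ {m n} → ⟦ m ⟧ ℚ.< ⟦ n ⟧ → m < n
⟦⟧-cancel-< {m} {n} p = ℤ.drop‿+<+ (subst₂ ℤ._<_ (ℤ.*-identityʳ (+ m)) (ℤ.*-identityʳ (+ n))
  (ℚ.drop-*<* (subst₂ ℚ._<_ (⟦⟧≡mkℚ m) (⟦⟧≡mkℚ n) p)))

⟦⟧-mono-≤ : ∀ {m n} → m ≤ n → ⟦ m ⟧ ℚ.≤ ⟦ n ⟧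
⟦⟧-mono-≤ {m} {n} m≤n = subst₂ ℚ._≤_ (sym (⟦⟧≡mkℚ m)) (sym (⟦⟧≡mkℚ n))
  (*≤* (subst₂ ℤ._≤_ (sym (ℤ.*-identityʳ (+ m))) (sym (ℤ.*-identityʳ (+ n))) (+≤+ m≤n)))

⟦⟧-mono-< : ∀ {m n} → m < n → ⟦ m ⟧ ℚ.< ⟦ n ⟧
⟦⟧-mono-< {m} {n} m<n = subst₂ ℚ._<_ (sym (⟦⟧≡mkℚ m)) (sym (⟦⟧≡mkℚ n))
  (*<* (subst₂ ℤ._<_ (sym (ℤ.*-identityʳ (+ m))) (sym (ℤ.*-identityʳ (+ n))) (+<+ m<n)))

openIntervals-meet : ∀ {a b c d} → a < b → c < d → a < d → c < b →
                     Σ ℚ λ q → OpenInterval a b q × OpenInterval c d q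
openIntervals-meet {a} {b} {c} {d} a<b c<d a<d c<b =
  let (q , ⊔<q , q<⊓) = ℚ.<-dense (⟦⟧-mono-< (⊓-pres-m< (⊔-pres-<m a<b c<b) (⊔-pres-<m a<d c<d)))
  in q , (ℚ.≤-<-trans (⟦⟧-mono-≤ (m≤m⊔n a c)) ⊔<q , ℚ.<-≤-trans q<⊓ (⟦⟧-mono-≤ (m⊓n≤m b d)))
       , (ℚ.≤-<-trans (⟦⟧-mono-≤ (m≤n⊔m a c)) ⊔<q , ℚ.<-≤-trans q<⊓ (⟦⟧-mono-≤ (m⊓n≤n b d)))

m%n≡o%n∧m/n<o/n⇒n+m≤o : ∀ {m n o} .{{_ : NonZero n}} → m % n ≡ o % n → m / n < o / n → n + m ≤ o
m%n≡o%n∧m/n<o/n⇒n+m≤o {m} {n} {o} eq q<q′ = begin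
  n + m                       ≡⟨ cong (_+_ n) (m≡m%n+[m/n]*n m n) ⟩
  n + (m % n + m / n * n)     ≡⟨ x∙yz≈y∙xz n (m % n) (m / n * n) ⟩
  m % n + suc (m / n) * n     ≤⟨ +-mono-≤ (≤-reflexive eq) (*-monoˡ-≤ n q<q′) ⟩
  o % n + o / n * n           ≡⟨ m≡m%n+[m/n]*n o n ⟨
  o                           ∎
  where open ≤-Reasoning

%-injective-on-window : ∀ {m n o} .{{_ : NonZero n}} → m % n ≡ o % n → m < n + o → o < n + m → m ≡ o
%-injective-on-window {m} {n} {o} eq m<n+o o<n+m with <-cmp (m / n) (o / n)
... | tri< m/n<o/n _ _ = contradiction o<n+m (≤⇒≯ (m%n≡o%n∧m/n<o/n⇒n+m≤o eq m/n<o/n))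
... | tri> _ _ o/n<m/n = contradiction m<n+o (≤⇒≯ (m%n≡o%n∧m/n<o/n⇒n+m≤o (sym eq) o/n<m/n))
... | tri≈ _ m/n≡o/n _ = begin
  m                   ≡⟨ m≡m%n+[m/n]*n m n ⟩
  m % n + m / n * n   ≡⟨ cong₂ (λ r q → r + q * n) eq m/n≡o/n ⟩
  o % n + o / n * n   ≡⟨ m≡m%n+[m/n]*n o n ⟨
  o                   ∎
  where open ≡-Reasoning

open J₃ using () renaming (a to left; b to right; a<b to left<right; len to length)

𝒢 : Graph
𝒢 = IntersectionGraph-J₃

Overlap : J₃ → J₃ → Set
Overlap I J = left I < right J × left J < right I

overlap? : ∀ I J → Dec (Overlap I J)
overlap? I J = (left I <? right J) ×-dec (left J <? right I)

overlap-refl : ∀ I → Overlap I I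
overlap-refl I = left<right I , left<right I

sameLeft⇒overlap : ∀ {I J} → left I ≡ left J → Overlap I J
sameLeft⇒overlap {I} {J} eq =
  subst (_< right J) (sym eq) (left<right J) , subst (_< right I) eq (left<right I)

adjacent⇒overlap : ∀ {I J} → Adj 𝒢 I J → Overlap I J
adjacent⇒overlap (_ , _ , (I<q , q<I) , (J<q , q<J)) =
  ⟦⟧-cancel-< (ℚ.<-trans I<q q<J) , ⟦⟧-cancel-< (ℚ.<-trans J<q q<I)

overlap⇒adjacent : ∀ {I J} → I ≢ J → Overlap I J → Adj 𝒢 I J
overlap⇒adjacent {I} {J} I≢J (I<J , J<I) =
  I≢J , openIntervals-meet (left<right I) (left<right J) I<J J<I

length≤3 : ∀ I → right I ∸ left I ≤ 3
length≤3 I with length I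
... | inj₁ l≡1        = ≤-trans (≤-reflexive l≡1) (s≤s z≤n)
... | inj₂ (inj₁ l≡2) = ≤-trans (≤-reflexive l≡2) (s≤s (s≤s z≤n))
... | inj₂ (inj₂ l≡3) = ≤-reflexive l≡3

right≤3+left : ∀ I → right I ≤ 3 + left I
right≤3+left I = begin
  right I                    ≡⟨ m∸n+n≡m (<⇒≤ (left<right I)) ⟨
  right I ∸ left I + left I  ≤⟨ +-monoˡ-≤ (left I) (length≤3 I) ⟩
  3 + left I                 ∎
  where open ≤-Reasoning

inducedStar-size≤length : ∀ {P w} (s : InducedStarIn 𝒢 P w) → w ≤ right (proj₁ s) ∸ left (proj₁ s)
inducedStar-size≤length (c , ℓ , _ , _ , _ , ℓ-inj , adj , nonadj) =
  injective-into-range⇒≤ meet (λ i → m≤m⊔n (left c) (left (ℓ i)) , meet<right-c i) meet-injective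
  where
  meet : Fin _ → ℕ
  meet i = left c ⊔ left (ℓ i)
  meet<right-c : ∀ i → meet i < right c
  meet<right-c i = ⊔-pres-<m (left<right c) (proj₂ (adjacent⇒overlap (adj i)))
  meet<right-ℓ : ∀ i → meet i < right (ℓ i)
  meet<right-ℓ i = ⊔-pres-<m (proj₁ (adjacent⇒overlap (adj i))) (left<right (ℓ i))
  meet-injective : Injective _≡_ _≡_ meet
  meet-injective {i} {j} eq = decidable-stable (i ≟ᶠ j) λ i≢j →
    nonadj i j i≢j (overlap⇒adjacent (ℓ-inj i j i≢j)
      ( ≤-<-trans (m≤n⊔m (left c) _) (subst (_< right (ℓ j)) (sym eq) (meet<right-ℓ j))
      , ≤-<-trans (m≤n⊔m (left c) _) (subst (_< right (ℓ i)) eq (meet<right-ℓ i))))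

DisjointOverlaps : ∀ {n} → J₃ → (Fin n → J₃) → Set
DisjointOverlaps c ℓ = (∀ i → Overlap c (ℓ i)) × (∀ i j → i ≢ j → ¬ Overlap (ℓ i) (ℓ j))

disjointOverlaps? : ∀ {n} c (ℓ : Fin n → J₃) → Dec (DisjointOverlaps c ℓ)
disjointOverlaps? c ℓ =
  all? (λ i → overlap? c (ℓ i))
  ×-dec all? (λ i → all? λ j → ¬? (i ≟ᶠ j) →-dec ¬? (overlap? (ℓ i) (ℓ j)))

-- With at least two leaves, a leaf equal to the centre would overlap another leaf.
disjointOverlaps⇒inducedStar : ∀ {n} c (ℓ : Fin (2 + n) → J₃) →
                               DisjointOverlaps c ℓ → IsInducedStar 𝒢 c ℓ
disjointOverlaps⇒inducedStar c ℓ (overlaps , disjoint) =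
  ℓ≢c , ℓ-inj , (λ i → overlap⇒adjacent (≢-sym (ℓ≢c i)) (overlaps i)) ,
  (λ i j i≢j → disjoint i j i≢j ∘ adjacent⇒overlap)
  where
  ℓ-inj : ∀ i j → i ≢ j → ℓ i ≢ ℓ j
  ℓ-inj i j i≢j ℓi≡ℓj = disjoint i j i≢j (subst (Overlap (ℓ i)) ℓi≡ℓj (overlap-refl (ℓ i)))
  ℓ≢c : ∀ i → ℓ i ≢ c
  ℓ≢c zero    ℓ₀≡c = disjoint zero (suc zero) (λ ())
    (subst (λ v → Overlap v (ℓ (suc zero))) (sym ℓ₀≡c) (overlaps (suc zero)))
  ℓ≢c (suc i) ℓᵢ≡c = disjoint (suc i) zero (λ ())
    (subst (λ v → Overlap v (ℓ zero)) (sym ℓᵢ≡c) (overlaps zero))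

inducedStar : ∀ {n} c (ℓ : Fin (2 + n) → J₃) → {True (disjointOverlaps? c ℓ)} → IsInducedStar 𝒢 c ℓ
inducedStar c ℓ {ok} = disjointOverlaps⇒inducedStar c ℓ (toWitness ok)

cherry : ∀ {x c y} → {True (disjointOverlaps? c (x ∷ y ∷ []))} → Cherry 𝒢 x c y
cherry {x} {c} {y} {ok} = inducedStar c (x ∷ y ∷ []) {ok}

length? : ∀ d → Dec ((d ≡ 1) ⊎ (d ≡ 2) ⊎ (d ≡ 3))
length? d = (d ≟ 1) ⊎-dec (d ≟ 2) ⊎-dec (d ≟ 3)

⦅_,_⦆ : (m n : ℕ) → {True (m <? n)} → {True (n ≤? 5)} → {True (length? (n ∸ m))} → J₃
⦅ m , n ⦆ {m<n} {n≤5} {len} = iv m n (toWitness m<n) (toWitness n≤5) (toWitness len)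

clawNumber-J₃ : ClawNumber 𝒢 3
clawNumber-J₃ = (⦅ 1 , 4 ⦆ , leaves , _ , _ , inducedStar ⦅ 1 , 4 ⦆ leaves) ,
                λ w star → ≤-trans (inducedStar-size≤length star) (length≤3 (proj₁ star))
  where
  leaves : Fin 3 → J₃
  leaves = ⦅ 1 , 2 ⦆ ∷ ⦅ 2 , 3 ⦆ ∷ ⦅ 3 , 4 ⦆ ∷ []

residue : J₃ → Fin 3
residue I = left I mod 3

sameResidue∧overlap⇒sameLeft : ∀ {I J} → residue I ≡ residue J → Overlap I J → left I ≡ left J
sameResidue∧overlap⇒sameLeft {I} {J} eq (I<J , J<I) =
  %-injective-on-window (fromℕ<-injective _ _ _ _ eq)
    (<-≤-trans I<J (right≤3+left J)) (<-≤-trans J<I (right≤3+left I))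

residueClass-noCherry : ∀ p → ¬ InducedStarIn 𝒢 (λ I → residue I ≡ p) 2
residueClass-noCherry p (c , ℓ , c∈p , ℓ∈p , _ , ℓ-inj , adj , nonadj) =
  nonadj zero (suc zero) (λ ()) (overlap⇒adjacent (ℓ-inj zero (suc zero) (λ ()))
    (sameLeft⇒overlap {ℓ zero} {ℓ (suc zero)}
      (trans (sym (sameLeft-c zero)) (sameLeft-c (suc zero)))))
  where
  sameLeft-c : ∀ i → left c ≡ left (ℓ i)
  sameLeft-c i =
    sameResidue∧overlap⇒sameLeft {c} {ℓ i} (trans c∈p (sym (ℓ∈p i))) (adjacent⇒overlap (adj i))

residuePartition : PartitionClawAtMost 𝒢 3 1
residuePartition = residue , λ p → noInducedStar⇒clawAtMost {𝒢} (residueClass-noCherry p)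

noTwoPartition : ¬ PartitionClawAtMost 𝒢 2 1
noTwoPartition (π , clawFree) = π₂₃≢π₂₅ (≢-≢⇒≡ π₂₃≢π₀₃ π₂₅≢π₀₃)
  where
  open TwoParts {𝒢} π clawFree
  π₂₃≢π₀₃ : π ⦅ 2 , 3 ⦆ ≢ π ⦅ 0 , 3 ⦆
  π₂₃≢π₀₃ = fan-separates ⦅ 0 , 1 ⦆ ⦅ 0 , 2 ⦆ ⦅ 1 , 2 ⦆ ⦅ 0 , 3 ⦆ ⦅ 2 , 3 ⦆ cherry cherry cherry cherry
  π₂₅≢π₀₃ : π ⦅ 2 , 5 ⦆ ≢ π ⦅ 0 , 3 ⦆
  π₂₅≢π₀₃ = fan-separates ⦅ 0 , 1 ⦆ ⦅ 0 , 2 ⦆ ⦅ 1 , 2 ⦆ ⦅ 0 , 3 ⦆ ⦅ 2 , 5 ⦆ cherry cherry cherry cherry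
  π₂₃≢π₂₅ : π ⦅ 2 , 3 ⦆ ≢ π ⦅ 2 , 5 ⦆
  π₂₃≢π₂₅ = fan-separates ⦅ 4 , 5 ⦆ ⦅ 3 , 5 ⦆ ⦅ 3 , 4 ⦆ ⦅ 2 , 5 ⦆ ⦅ 2 , 3 ⦆ cherry cherry cherry cherry

lemma4 : ClawNumber IntersectionGraph-J₃ 3
         × PartitionClawAtMost IntersectionGraph-J₃ 3 1
         × ¬ PartitionClawAtMost IntersectionGraph-J₃ 2 1
lemma4 = clawNumber-J₃ , residuePartition , noTwoPartition
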